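{- Suppose that for all integers $d\ge 7$ and $i$ with $d<i<Z(d)$ one has $f_{\triangle}(d,i)=di+i-d+1$. Then for integers $7\le d<m<Z(d)$, the integer program \[ \max\ \lfloor d/2\rfloor x_{Z(d)}+\sum_{i=d}^{Z(d)-1}(i-d+1)x_i \quad\text{subject to}\quad \sum_{i=d}^{Z(d)} i\,x_i\le m,\ \ x_i\in\mathbb{Z}_{\ge 0}\ (d\le i\le Z(d)) \] admits an optimal solution with $\sum_{i=d}^{Z(d)-1}x_i\le 1$.
   Context: All graphs are finite, simple and undirected. A graph is triangle-free if it has no three pairwise adjacent vertices. $\Delta(G)$ is the maximum degree and $\nu(G)$ the matching number of $G$. For positive integers $d,m$, $f_{\triangle}(d,m)$ is the maximum number of edges of a triangle-free graph $G$ with $\Delta(G)\le d$ and $\nu(G)\le m$. A graph $G$ is factor-critical if $G-v$ has a perfect matching for every vertex $v$. A graph is almost $d$-regular if one vertex has degree $d-1$ and all other vertices have degree $d$. For $d\ge 2$, $Z(d)$ is the smallest positive integer $n$ such that there exists a triangle-free factor-critical graph $G$ with $\nu(G)=n$ that is $d$-regular (if $d$ is even) or almost $d$-regular (if $d$ is odd). -}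

module Defs where

open import Data.Nat using (ℕ; zero; suc; _+_; _*_; _∸_; _≤_; _<_; _<ᵇ_)
open import Data.Nat.DivMod using (_%_; _/_)
open import Data.Bool using (Bool; true; false; T; _∧_; if_then_else_)
open import Data.Fin using (Fin; toℕ)
open import Data.Nat.ListAction using (sum)
open import Data.List using (List; []; _∷_; map; length; allFin; upTo; concatMap)
open import Data.List.Relation.Unary.All using (All)
open import Data.List.Relation.Unary.Unique.Propositional using (Unique)
open import Data.List.Membership.Propositional using (_∈_; _∉_)
open import Data.Product using (Σ; _×_; _,_; ∃; ∃-syntax; proj₁; proj₂)
open import Data.Sum using (_⊎_)
open import Data.Empty using (⊥)
open import Relation.Binary.PropositionalEquality using (_≡_; _≢_)

record Graph : Set where
  field
    n     : ℕ
    adj   : Fin n → Fin n → Bool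
    sym   : ∀ u v → adj u v ≡ adj v u
    irrefl : ∀ v → adj v v ≡ false
open Graph public

Vertex : Graph → Set
Vertex G = Fin (n G)

indicator : Bool → ℕ
indicator true  = 1
indicator false = 0

deg : (G : Graph) → Vertex G → ℕ
deg G u = sum (map (λ v → indicator (adj G u v)) (allFin (n G)))

edgeCount : (G : Graph) → ℕ
edgeCount G = sum (map (λ u → sum (map (λ v → indicator (adj G u v ∧ (toℕ u <ᵇ toℕ v))) (allFin (n G)))) (allFin (n G)))

MaxDegLe : Graph → ℕ → Set
MaxDegLe G d = ∀ v → deg G v ≤ d

TriangleFree : Graph → Set
TriangleFree G = ∀ a b c → T (adj G a b) → T (adj G b c) → T (adj G a c) → ⊥

endpoints : {k : ℕ} → List (Fin k × Fin k) → List (Fin k)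
endpoints = concatMap (λ e → proj₁ e ∷ proj₂ e ∷ [])

IsMatching : (G : Graph) → List (Vertex G × Vertex G) → Set
IsMatching G M = All (λ e → T (adj G (proj₁ e) (proj₂ e))) M × Unique (endpoints M)

MatchingNumberLe : Graph → ℕ → Set
MatchingNumberLe G m = ∀ M → IsMatching G M → length M ≤ m

MatchingNumberEq : Graph → ℕ → Set
MatchingNumberEq G m =
  (Σ (List (Vertex G × Vertex G)) λ M → IsMatching G M × length M ≡ m)
  × MatchingNumberLe G m

PerfectMatchingWithout : (G : Graph) → Vertex G → Set
PerfectMatchingWithout G v =
  Σ (List (Vertex G × Vertex G)) λ M →
    IsMatching G M × v ∉ endpoints M × (∀ u → u ≢ v → u ∈ endpoints M)

FactorCritical : Graph → Set
FactorCritical G = ∀ v → PerfectMatchingWithout G v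

Regular : Graph → ℕ → Set
Regular G d = ∀ v → deg G v ≡ d

AlmostRegular : Graph → ℕ → Set
AlmostRegular G d = Σ (Vertex G) λ w → deg G w ≡ d ∸ 1 × (∀ v → v ≢ w → deg G v ≡ d)

RegCond : Graph → ℕ → Set
RegCond G d = (d % 2 ≡ 0 × Regular G d) ⊎ (d % 2 ≡ 1 × AlmostRegular G d)

ZWitness : ℕ → ℕ → Set
ZWitness d k = Σ Graph λ G → TriangleFree G × FactorCritical G × MatchingNumberEq G k × RegCond G d

IsZ : ℕ → ℕ → Set
IsZ d z = 0 < z × ZWitness d z × (∀ k → 0 < k → ZWitness d k → z ≤ k)

IsFtri : ℕ → ℕ → ℕ → Set
IsFtri d m v =
  (Σ Graph λ G → TriangleFree G × MaxDegLe G d × MatchingNumberLe G m × edgeCount G ≡ v)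
  × (∀ G → TriangleFree G → MaxDegLe G d → MatchingNumberLe G m → edgeCount G ≤ v)

-- Σ_{i=a}^{b} f i  (empty if b < a)
sumFromTo : ℕ → ℕ → (ℕ → ℕ) → ℕ
sumFromTo a b f = sum (map (λ k → f (a + k)) (upTo (suc b ∸ a)))

objective : ℕ → ℕ → (ℕ → ℕ) → ℕ
objective d z x = (d / 2) * x z + sumFromTo d (z ∸ 1) (λ i → (i ∸ d + 1) * x i)

Feasible : ℕ → ℕ → ℕ → (ℕ → ℕ) → Set
Feasible d z m x = sumFromTo d z (λ i → i * x i) ≤ m

Optimal : ℕ → ℕ → ℕ → (ℕ → ℕ) → Set
Optimal d z m x = Feasible d z m x × (∀ y → Feasible d z m y → objective d z y ≤ objective d z x)

-- Since z > m, the variable x_z is forced to 0 by the knapsack constraint.  Every other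
-- variable x_i has value i - (d - 1), so the objective of a feasible y equals
-- Σ i y_i - (d - 1) Σ y_i ≤ m - (d - 1) whenever y ≠ 0.  The unit vector at m attains
-- this value and has a single nonzero coordinate.
module Submission where

open import Defs hiding (sym)
open import Data.Nat using (ℕ; _+_; _*_; _∸_; _≤_; _<_; zero; suc; z≤n; s≤s; s≤s⁻¹; _≡ᵇ_; _/_)
open import Data.Nat.Properties
open import Data.Nat.ListAction using (sum)
open import Data.Nat.ListAction.Properties using (sum-++)
open import Algebra.Properties.CommutativeSemigroup +-commutativeSemigroup using (interchange)
open import Data.List using (List; []; _∷_; [_]; _++_; map; upTo)
open import Data.List.Properties using (map-++; map-cong; upTo-∷ʳ)
open import Data.Product using (Σ; _×_; _,_)
open import Data.Sum using (_⊎_; inj₁; inj₂)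
open import Data.Bool using (true; false; T)
open import Data.Empty using (⊥-elim)
open import Relation.Binary.PropositionalEquality
  using (_≡_; _≢_; refl; sym; trans; cong; cong₂; subst; module ≡-Reasoning)

private
  variable
    A : Set
    a b : ℕ
    f g : ℕ → ℕ

sum-map-+ : (f g : A → ℕ) (xs : List A) →
            sum (map (λ x → f x + g x) xs) ≡ sum (map f xs) + sum (map g xs)
sum-map-+ f g []       = refl
sum-map-+ f g (x ∷ xs) =
  trans (cong (f x + g x +_) (sum-map-+ f g xs)) (interchange (f x) (g x) _ _)

sum-map-*ˡ : (c : ℕ) (f : A → ℕ) (xs : List A) →
             sum (map (λ x → c * f x) xs) ≡ c * sum (map f xs)
sum-map-*ˡ c f []       = sym (*-zeroʳ c)
sum-map-*ˡ c f (x ∷ xs) =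
  trans (cong (c * f x +_) (sum-map-*ˡ c f xs)) (sym (*-distribˡ-+ c (f x) _))

sum-map-*-≡0 : (f g : A → ℕ) (xs : List A) →
               sum (map g xs) ≡ 0 → sum (map (λ x → f x * g x) xs) ≡ 0
sum-map-*-≡0 f g []       _  = refl
sum-map-*-≡0 f g (x ∷ xs) eq = cong₂ _+_
  (trans (cong (f x *_) (m+n≡0⇒m≡0 (g x) eq)) (*-zeroʳ (f x)))
  (sum-map-*-≡0 f g xs (m+n≡0⇒n≡0 (g x) eq))

sum-map-upTo-suc : ∀ (f : ℕ → ℕ) n → sum (map f (upTo (suc n))) ≡ sum (map f (upTo n)) + f n
sum-map-upTo-suc f n = begin
  sum (map f (upTo (suc n)))            ≡⟨ cong (λ xs → sum (map f xs)) (sym (upTo-∷ʳ n)) ⟩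
  sum (map f (upTo n ++ [ n ]))         ≡⟨ cong sum (map-++ f (upTo n) [ n ]) ⟩
  sum (map f (upTo n) ++ [ f n ])       ≡⟨ sum-++ (map f (upTo n)) [ f n ] ⟩
  sum (map f (upTo n)) + (f n + 0)      ≡⟨ cong (sum (map f (upTo n)) +_) (+-identityʳ (f n)) ⟩
  sum (map f (upTo n)) + f n            ∎
  where open ≡-Reasoning

sum-map-upTo-≡0 : ∀ (f : ℕ → ℕ) n → (∀ k → k < n → f k ≡ 0) → sum (map f (upTo n)) ≡ 0
sum-map-upTo-≡0 f zero    _    = refl
sum-map-upTo-≡0 f (suc n) vanish =
  trans (sum-map-upTo-suc f n)
        (cong₂ _+_ (sum-map-upTo-≡0 f n (λ k k<n → vanish k (m≤n⇒m≤1+n k<n))) (vanish n ≤-refl))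

sum-map-upTo-single : ∀ (f : ℕ → ℕ) n {j} → j < n → (∀ k → k ≢ j → f k ≡ 0) →
                      sum (map f (upTo n)) ≡ f j
sum-map-upTo-single f (suc n) {j} j<1+n off =
  trans (sum-map-upTo-suc f n) (last (m<1+n⇒m<n∨m≡n j<1+n))
  where
  last : j < n ⊎ j ≡ n → sum (map f (upTo n)) + f n ≡ f j
  last (inj₁ j<n) = trans (cong₂ _+_ (sum-map-upTo-single f n j<n off) (off n (>⇒≢ j<n)))
                          (+-identityʳ (f j))
  last (inj₂ refl) = cong (_+ f j) (sum-map-upTo-≡0 f j (λ k k<j → off k (<⇒≢ k<j)))

sumFromTo-+ : ∀ a b (f g : ℕ → ℕ) →
              sumFromTo a b (λ i → f i + g i) ≡ sumFromTo a b f + sumFromTo a b g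
sumFromTo-+ a b f g = sum-map-+ (λ k → f (a + k)) (λ k → g (a + k)) (upTo (suc b ∸ a))

sumFromTo-*ˡ : ∀ a b c (f : ℕ → ℕ) → sumFromTo a b (λ i → c * f i) ≡ c * sumFromTo a b f
sumFromTo-*ˡ a b c f = sum-map-*ˡ c (λ k → f (a + k)) (upTo (suc b ∸ a))

sumFromTo-*-≡0 : ∀ a b (f g : ℕ → ℕ) →
                 sumFromTo a b g ≡ 0 → sumFromTo a b (λ i → f i * g i) ≡ 0
sumFromTo-*-≡0 a b f g = sum-map-*-≡0 (λ k → f (a + k)) (λ k → g (a + k)) (upTo (suc b ∸ a))

sumFromTo-cong : ∀ a b → (∀ i → a ≤ i → f i ≡ g i) → sumFromTo a b f ≡ sumFromTo a b g
sumFromTo-cong a b eq = cong sum (map-cong (λ k → eq (a + k) (m≤m+n a k)) (upTo (suc b ∸ a)))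

sumFromTo-last : a ≤ suc b → sumFromTo a (suc b) f ≡ sumFromTo a b f + f (suc b)
sumFromTo-last {a} {b} {f} a≤1+b = begin
  sum (map F (upTo (suc (suc b) ∸ a)))  ≡⟨ cong (λ n → sum (map F (upTo n))) (+-∸-assoc 1 a≤1+b) ⟩
  sum (map F (upTo (suc (suc b ∸ a))))  ≡⟨ sum-map-upTo-suc F (suc b ∸ a) ⟩
  sumFromTo a b f + F (suc b ∸ a)       ≡⟨ cong (λ i → sumFromTo a b f + f i) (m+[n∸m]≡n a≤1+b) ⟩
  sumFromTo a b f + f (suc b)           ∎
  where
  open ≡-Reasoning
  F : ℕ → ℕ
  F k = f (a + k)

sumFromTo-single : ∀ {j} → a ≤ j → j ≤ b → (∀ i → i ≢ j → f i ≡ 0) → sumFromTo a b f ≡ f j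
sumFromTo-single {a} {b} {f} {j} a≤j j≤b off =
  trans (sum-map-upTo-single (λ k → f (a + k)) (suc b ∸ a) (∸-monoˡ-< (s≤s j≤b) a≤j) off-offset)
        (cong f (m+[n∸m]≡n a≤j))
  where
  off-offset : ∀ k → k ≢ j ∸ a → f (a + k) ≡ 0
  off-offset k k≢ = off (a + k) (λ a+k≡j → k≢ (trans (sym (m+n∸m≡n a k)) (cong (_∸ a) a+k≡j)))

unit : ℕ → ℕ → ℕ
unit m i = indicator (i ≡ᵇ m)

unit-≡ : ∀ m → unit m m ≡ 1
unit-≡ m with m ≡ᵇ m | ≡⇒≡ᵇ m m refl
... | true | _ = refl

unit-≢ : ∀ {m i} → i ≢ m → unit m i ≡ 0
unit-≢ {m} {i} i≢m with i ≡ᵇ m in eq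
... | false = refl
... | true  = ⊥-elim (i≢m (≡ᵇ⇒≡ i m (subst T (sym eq) _)))

sumFromTo-*-unit : ∀ {m} (g : ℕ → ℕ) → a ≤ m → m ≤ b →
                   sumFromTo a b (λ i → g i * unit m i) ≡ g m
sumFromTo-*-unit {m = m} g a≤m m≤b =
  trans (sumFromTo-single a≤m m≤b (λ i i≢m → trans (cong (g i *_) (unit-≢ i≢m)) (*-zeroʳ (g i))))
        (trans (cong (g m *_) (unit-≡ m)) (*-identityʳ (g m)))

module _ {d z m : ℕ} {y : ℕ → ℕ} (d≤1+z : d ≤ suc z) (feasible : Feasible d (suc z) m y) where

  Feasible-split : sumFromTo d z (λ i → i * y i) + suc z * y (suc z) ≤ m
  Feasible-split = subst (_≤ m) (sumFromTo-last {f = λ i → i * y i} d≤1+z) feasible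

  Feasible⇒top≡0 : m < suc z → y (suc z) ≡ 0
  Feasible⇒top≡0 m<1+z with y (suc z) in eq
  ... | zero  = refl
  ... | suc t = ⊥-elim (<⇒≱ m<1+z (≤-trans (m≤m*n (suc z) (suc t))
                  (m+n≤o⇒n≤o below (subst (λ k → below + suc z * k ≤ m) eq Feasible-split))))
    where
    below : ℕ
    below = sumFromTo d z (λ i → i * y i)

value-+-weight : ∀ {d' i} k → suc d' ≤ i → (i ∸ suc d' + 1) * k + d' * k ≡ i * k
value-+-weight {d'} {i} k d≤i = trans (sym (*-distribʳ-+ k (i ∸ suc d' + 1) d'))
                                      (cong (_* k) (trans (+-assoc (i ∸ suc d') 1 d') (m∸n+n≡m d≤i)))

value-+-count : ∀ d' z (y : ℕ → ℕ) →
                sumFromTo (suc d') z (λ i → (i ∸ suc d' + 1) * y i) + d' * sumFromTo (suc d') z y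
                ≡ sumFromTo (suc d') z (λ i → i * y i)
value-+-count d' z y = begin
  value + d' * sumFromTo (suc d') z y
    ≡⟨ cong (value +_) (sumFromTo-*ˡ (suc d') z d' y) ⟨
  value + sumFromTo (suc d') z (λ i → d' * y i)
    ≡⟨ sumFromTo-+ (suc d') z coefficient (λ i → d' * y i) ⟨
  sumFromTo (suc d') z (λ i → coefficient i + d' * y i)
    ≡⟨ sumFromTo-cong (suc d') z (λ i → value-+-weight (y i)) ⟩
  sumFromTo (suc d') z (λ i → i * y i)
    ∎
  where
  open ≡-Reasoning
  coefficient : ℕ → ℕ
  coefficient i = (i ∸ suc d' + 1) * y i
  value : ℕ
  value = sumFromTo (suc d') z coefficient

value-≤ : ∀ {d' m} value count → suc d' ≤ m → (count ≡ 0 → value ≡ 0) →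
          value + d' * count ≤ m → value ≤ m ∸ suc d' + 1
value-≤ {d'} {m} value zero    _   value≡0 _ = subst (_≤ m ∸ suc d' + 1) (sym (value≡0 refl)) z≤n
value-≤ {d'} {m} value (suc c) d≤m _       bound = begin
  value            ≤⟨ m+n≤o⇒m≤o∸n value (≤-trans (+-monoʳ-≤ value (m≤m*n d' (suc c))) bound) ⟩
  m ∸ d'           ≡⟨ +-∸-assoc 1 d≤m ⟩
  1 + (m ∸ suc d') ≡⟨ +-comm 1 (m ∸ suc d') ⟩
  m ∸ suc d' + 1   ∎
  where open ≤-Reasoning

objective-≤ : ∀ {d' z m y} → suc d' ≤ m → m < suc z → Feasible (suc d') (suc z) m y →
              objective (suc d') (suc z) y ≤ m ∸ suc d' + 1
objective-≤ {d'} {z} {m} {y} d≤m m<1+z feasible = begin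
  suc d' / 2 * y (suc z) + value  ≡⟨ cong (λ k → suc d' / 2 * k + value) top≡0 ⟩
  suc d' / 2 * 0 + value          ≡⟨ cong (_+ value) (*-zeroʳ (suc d' / 2)) ⟩
  value                           ≤⟨ value-≤ value count d≤m count≡0⇒value≡0 value-+-count-≤ ⟩
  m ∸ suc d' + 1                  ∎
  where
  open ≤-Reasoning
  d≤1+z : suc d' ≤ suc z
  d≤1+z = ≤-trans d≤m (<⇒≤ m<1+z)
  value count : ℕ
  value = sumFromTo (suc d') z (λ i → (i ∸ suc d' + 1) * y i)
  count = sumFromTo (suc d') z y
  top≡0 : y (suc z) ≡ 0
  top≡0 = Feasible⇒top≡0 {y = y} d≤1+z feasible m<1+z
  count≡0⇒value≡0 : count ≡ 0 → value ≡ 0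
  count≡0⇒value≡0 = sumFromTo-*-≡0 (suc d') z (λ i → i ∸ suc d' + 1) y
  value-+-count-≤ : value + d' * count ≤ m
  value-+-count-≤ = subst (_≤ m) (sym (value-+-count d' z y))
                          (m+n≤o⇒m≤o _ (Feasible-split {y = y} d≤1+z feasible))

unit-optimal : ∀ {d z m} → 0 < d → d ≤ m → m < z → Optimal d z m (unit m)
unit-optimal {suc d'} {suc z} {m} _ d≤m m<1+z =
  ≤-reflexive (sumFromTo-*-unit (λ i → i) d≤m (<⇒≤ m<1+z)) ,
  λ y feasible → ≤-trans (objective-≤ {y = y} d≤m m<1+z feasible)
                         (≤-reflexive (sym objective-unit))
  where
  objective-unit : objective (suc d') (suc z) (unit m) ≡ m ∸ suc d' + 1
  objective-unit = cong₂ _+_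
    (trans (cong (suc d' / 2 *_) (unit-≢ (>⇒≢ m<1+z))) (*-zeroʳ (suc d' / 2)))
    (sumFromTo-*-unit (λ i → i ∸ suc d' + 1) d≤m (s≤s⁻¹ m<1+z))

sumFromTo-unit : ∀ {a b m} → a ≤ m → m ≤ b → sumFromTo a b (unit m) ≡ 1
sumFromTo-unit {a} {b} {m} a≤m m≤b =
  trans (sumFromTo-cong a b (λ i _ → sym (*-identityˡ (unit m i))))
        (sumFromTo-*-unit (λ _ → 1) a≤m m≤b)

proposition3 : (∀ d z i → 7 ≤ d → IsZ d z → d < i → i < z → IsFtri d i (d * i + i ∸ d + 1))
    → ∀ d z m → 7 ≤ d → IsZ d z → d < m → m < z
    → Σ (ℕ → ℕ) λ x → Optimal d z m x × sumFromTo d (z ∸ 1) x ≤ 1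
proposition3 _ d z m 7≤d _ d<m m<z =
  unit m , unit-optimal (≤-trans (s≤s z≤n) 7≤d) (<⇒≤ d<m) m<z ,
  ≤-reflexive (sumFromTo-unit (<⇒≤ d<m) (pred-mono-≤ m<z))
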